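{- Let $\mathcal{U}$ be a coinfinite subset of $\mathcal{V}$ and let $(S,T)$ be a finitely consistent pair of subsets of $\Phi(\mathcal{U})$. Then there exist a coinfinite subset $\mathcal{U}'$ of $\mathcal{V}$ and a $\mathcal{U}'$-saturated pair $(S',T')$ such that $\mathcal{U}\subseteq\mathcal{U}'$, $S\subseteq S'$ and $T\subseteq T'$.
   Context: Formulas are those of first-order modal logic over a countable set $\mathcal{V}$ of variables, with $\top,\bot$, predicate symbols of each finite arity (no function/constant symbols), $\land,\neg,\supset$, $\forall$, and $\Box$; $\Diamond=\neg\Box\neg$. For a formula $\phi$, $\mathsf{Var}(\phi)$ is the set of variables with a free or bound occurrence in $\phi$, and for $\mathcal{U}\subseteq\mathcal{V}$, $\Phi(\mathcal{U})$ is the set of formulas $\phi$ with $\mathsf{Var}(\phi)\subseteq\mathcal{U}$. $\mathsf{NQGL}^-$ is the following sequent calculus (sequents $\Gamma\rightarrow\Delta$ are pairs of finite sets of formulas). Axioms: $p\rightarrow p$ ($p$ atomic), $\rightarrow\top$, $\bot\rightarrow$. Rules: weakening (from $\Gamma\rightarrow\Delta$ infer $\Gamma'\rightarrow\Delta'$ for $\Gamma\subseteq\Gamma'$, $\Delta\subseteq\Delta'$); standard LK rules for $\land$ (right: from $\Gamma\rightarrow\Delta,\phi$ and $\Gamma\rightarrow\Delta,\psi$ infer $\Gamma\rightarrow\Delta,\phi\land\psi$; left: from $\phi,\Gamma\rightarrow\Delta$ or $\psi,\Gamma\rightarrow\Delta$ infer $\phi\land\psi,\Gamma\rightarrow\Delta$),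 for $\supset$ (right: from $\phi,\Gamma\rightarrow\Delta,\psi$ infer $\Gamma\rightarrow\Delta,\phi\supset\psi$; left: from $\Gamma\rightarrow\Delta,\phi$ and $\psi,\Lambda\rightarrow\Xi$ infer $\phi\supset\psi,\Gamma,\Lambda\rightarrow\Delta,\Xi$), for $\neg$ (from $\phi,\Gamma\rightarrow\Delta$ infer $\Gamma\rightarrow\Delta,\neg\phi$; from $\Gamma\rightarrow\Delta,\phi$ infer $\neg\phi,\Gamma\rightarrow\Delta$), for $\forall$ (from $\Gamma\rightarrow\Delta,\phi[y/x]$ infer $\Gamma\rightarrow\Delta,\forall x\phi$ with $y$ not occurring in the lower sequent; from $\phi[z/x],\Gamma\rightarrow\Delta$ infer $\forall x\phi,\Gamma\rightarrow\Delta$ for any $z$); (Box) from $\Box\Gamma,\Delta\rightarrow\phi$ infer $\Box\Gamma,\Box\Delta\rightarrow\Box\phi$ (where $\Box\Gamma=\{\Box\gamma\mid\gamma\in\Gamma\}$); and (Boundedness of length) from $\Gamma\rightarrow\Delta,\Diamond^n\top$ for all $n\in\mathbb{N}$ infer $\Gamma\rightarrow\Delta$. There is no cut rule. $\vdash_{\mathsf{NQGL}^- }\Gamma\rightarrow\Delta$ means derivable (derivations may be infinitary). A pair $(S,T)$ of sets of formulas is finitely consistent if for all finite $S'\subseteq S$, $T'\subseteq T$, $\not\vdash_{\mathsf{NQGL}^- }S'\rightarrow T'$. For $\mathcal{U}\subseteq\mathcal{V}$, a finitely consistent pair $(S,T)$ of subsets of $\Phi(\mathcal{U})$ is $\mathcal{U}$-saturated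 if: (1) $\phi_1\land\phi_2\in S$ implies $\phi_1,\phi_2\in S$, and $\phi_1\land\phi_2\in T$ implies $\phi_1\in T$ or $\phi_2\in T$; (2) $\phi_1\supset\phi_2\in S$ implies $\phi_1\in T$ or $\phi_2\in S$, and $\phi_1\supset\phi_2\in T$ implies $\phi_1\in S$ and $\phi_2\in T$; (3) $\neg\phi\in S$ implies $\phi\in T$, and $\neg\phi\in T$ implies $\phi\in S$; (4) $\forall x\phi\in S$ implies $\phi[z/x]\in S$ for all $z\in\mathcal{U}$, and $\forall x\phi\in T$ implies $\phi[z/x]\in T$ for some $z\in\mathcal{U}$. -}

module Defs where

open import Data.Nat using (ℕ; zero; suc; _≤_; _≡ᵇ_)
open import Data.Bool using (if_then_else_)
open import Data.Vec using (Vec)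
import Data.Vec as Vec
open import Data.List using (List; []; _∷_; _++_; map; concatMap)
open import Data.List.Membership.Propositional using (_∈_)
open import Data.List.Relation.Unary.All using (All)
open import Data.List.Relation.Binary.Subset.Propositional using (_⊆_)
open import Data.Product using (Σ; _×_; ∃)
open import Data.Sum using (_⊎_)
open import Relation.Nullary using (¬_)

Var : Set
Var = ℕ

-- Predicate symbols: for each arity n, countably many symbols (indexed by ℕ).
-- No function or constant symbols.
data Formula : Set where
  atom : (n : ℕ) → (P : ℕ) → Vec Var n → Formula
  ⊤ᶠ ⊥ᶠ : Formula
  _∧ᶠ_ : Formula → Formula → Formula
  ¬ᶠ_ : Formula → Formula
  _⊃_ : Formula → Formula → Formula
  ∀ᶠ : Var → Formula → Formula
  □ : Formula → Formula

◇ : Formula → Formula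
◇ φ = ¬ᶠ (□ (¬ᶠ φ))

◇^_⊤ : ℕ → Formula
◇^ zero ⊤ = ⊤ᶠ
◇^ suc n ⊤ = ◇ (◇^ n ⊤)

data Atomic : Formula → Set where
  atomic : ∀ n P vs → Atomic (atom n P vs)

vars : Formula → List Var
vars (atom n P vs) = Vec.toList vs
vars ⊤ᶠ = []
vars ⊥ᶠ = []
vars (φ ∧ᶠ ψ) = vars φ ++ vars ψ
vars (¬ᶠ φ) = vars φ
vars (φ ⊃ ψ) = vars φ ++ vars ψ
vars (∀ᶠ x φ) = x ∷ vars φ
vars (□ φ) = vars φ

_[_/_] : Formula → Var → Var → Formula
atom n P vs [ z / x ] = atom n P (Vec.map (λ v → if v ≡ᵇ x then z else v) vs)
⊤ᶠ [ z / x ] = ⊤ᶠ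
⊥ᶠ [ z / x ] = ⊥ᶠ
(φ ∧ᶠ ψ) [ z / x ] = (φ [ z / x ]) ∧ᶠ (ψ [ z / x ])
(¬ᶠ φ) [ z / x ] = ¬ᶠ (φ [ z / x ])
(φ ⊃ ψ) [ z / x ] = (φ [ z / x ]) ⊃ (ψ [ z / x ])
∀ᶠ y φ [ z / x ] = if y ≡ᵇ x then ∀ᶠ y φ else ∀ᶠ y (φ [ z / x ])
□ φ [ z / x ] = □ (φ [ z / x ])

OccursIn : Var → List Formula → Set
OccursIn y Γ = y ∈ concatMap vars Γ

-- The sequent calculus NQGL⁻ (sequents: pairs of finite lists, read as
-- finite sets; weakening is w.r.t. set inclusion, so the list order and
-- multiplicities are irrelevant).

infix 3 _⟶_

data _⟶_ : List Formula → List Formula → Set where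
  ax    : ∀ p → Atomic p → (p ∷ []) ⟶ (p ∷ [])
  ax⊤   : [] ⟶ (⊤ᶠ ∷ [])
  ax⊥   : (⊥ᶠ ∷ []) ⟶ []
  weak  : ∀ {Γ Δ Γ' Δ'} → Γ ⟶ Δ → Γ ⊆ Γ' → Δ ⊆ Δ' → Γ' ⟶ Δ'
  ∧R    : ∀ {Γ Δ φ ψ} → Γ ⟶ φ ∷ Δ → Γ ⟶ ψ ∷ Δ → Γ ⟶ (φ ∧ᶠ ψ) ∷ Δ
  ∧L₁   : ∀ {Γ Δ φ ψ} → φ ∷ Γ ⟶ Δ → (φ ∧ᶠ ψ) ∷ Γ ⟶ Δ
  ∧L₂   : ∀ {Γ Δ φ ψ} → ψ ∷ Γ ⟶ Δ → (φ ∧ᶠ ψ) ∷ Γ ⟶ Δ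
  ⊃R    : ∀ {Γ Δ φ ψ} → φ ∷ Γ ⟶ ψ ∷ Δ → Γ ⟶ (φ ⊃ ψ) ∷ Δ
  ⊃L    : ∀ {Γ Δ Λ Ξ φ ψ} → Γ ⟶ φ ∷ Δ → ψ ∷ Λ ⟶ Ξ →
          (φ ⊃ ψ) ∷ (Γ ++ Λ) ⟶ Δ ++ Ξ
  ¬R    : ∀ {Γ Δ φ} → φ ∷ Γ ⟶ Δ → Γ ⟶ (¬ᶠ φ) ∷ Δ
  ¬L    : ∀ {Γ Δ φ} → Γ ⟶ φ ∷ Δ → (¬ᶠ φ) ∷ Γ ⟶ Δ
  ∀R    : ∀ {Γ Δ φ x y} → Γ ⟶ (φ [ y / x ]) ∷ Δ →
          ¬ OccursIn y (Γ ++ (∀ᶠ x φ) ∷ Δ) → Γ ⟶ (∀ᶠ x φ) ∷ Δ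
  ∀L    : ∀ {Γ Δ φ x} z → (φ [ z / x ]) ∷ Γ ⟶ Δ → (∀ᶠ x φ) ∷ Γ ⟶ Δ
  □rule : ∀ {Γ Δ φ} → map □ Γ ++ Δ ⟶ φ ∷ [] → map □ Γ ++ map □ Δ ⟶ □ φ ∷ []
  bound : ∀ {Γ Δ} → ((n : ℕ) → Γ ⟶ (◇^ n ⊤) ∷ Δ) → Γ ⟶ Δ

VarSet : Set₁
VarSet = Var → Set

FSet : Set₁
FSet = Formula → Set

_⊆ᵛ_ : VarSet → VarSet → Set
U ⊆ᵛ U' = ∀ x → U x → U' x

_⊆ᶠ_ : FSet → FSet → Set
S ⊆ᶠ S' = ∀ φ → S φ → S' φ

Coinfinite : VarSet → Set
Coinfinite U = ∀ n → ∃ λ m → n ≤ m × ¬ U m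

InΦ : VarSet → Formula → Set
InΦ U φ = All U (vars φ)

SubΦ : VarSet → FSet → Set
SubΦ U S = ∀ φ → S φ → InΦ U φ

FinitelyConsistent : FSet → FSet → Set
FinitelyConsistent S T =
  ∀ (Γ Δ : List Formula) → All S Γ → All T Δ → ¬ (Γ ⟶ Δ)

record Saturated (U : VarSet) (S T : FSet) : Set where
  field
    subS    : SubΦ U S
    subT    : SubΦ U T
    fincons : FinitelyConsistent S T
    ∧S : ∀ φ ψ → S (φ ∧ᶠ ψ) → S φ × S ψ
    ∧T : ∀ φ ψ → T (φ ∧ᶠ ψ) → T φ ⊎ T ψ
    ⊃S : ∀ φ ψ → S (φ ⊃ ψ) → T φ ⊎ S ψ
    ⊃T : ∀ φ ψ → T (φ ⊃ ψ) → S φ × T ψ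
    ¬S : ∀ φ → S (¬ᶠ φ) → T φ
    ¬T : ∀ φ → T (¬ᶠ φ) → S φ
    ∀S : ∀ x φ → S (∀ᶠ x φ) → ∀ z → U z → S (φ [ z / x ])
    ∀T : ∀ x φ → T (∀ᶠ x φ) → ∃ λ z → U z × T (φ [ z / x ])

-- Enumerate the formulas so that each one occurs infinitely often, and build an
-- increasing chain of finitely consistent pairs (Sₙ , Tₙ) over variable sets Uₙ, where
-- Uₙ₊₁ adds to Uₙ one fresh variable from the complement of U.  At stage n the n-th
-- formula χ is processed: if χ ∈ Sₙ its left saturation clause is enforced (for ∀x φ by
-- adding all instances over Uₙ, which ∀L absorbs), and if χ ∈ Tₙ its right clause (for
-- ∀x φ by instantiating the fresh variable, so that ∀R applies).  Where a clause offers a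
-- choice (φ ⊃ ψ on the left, φ ∧ ψ on the right), excluded middle decides whether φ can
-- consistently join the right side; if it cannot, the derivation witnessing this combines
-- by ⊃L, resp. ∧R, with any derivation refuting the other alternative.  The union of the
-- chain is saturated, and finitely consistent because every finite part of it lies in a
-- single stage.  The fresh variables sit at the even positions of an enumeration of the
-- complement of U, so the odd positions keep the union coinfinite.

module Submission where

open import Defs
open import Level using (0ℓ)
open import Axiom.ExcludedMiddle using (ExcludedMiddle)
open import Data.Nat
  using (ℕ; zero; suc; _+_; _*_; _⊔_; _≤_; _<_; _≤′_; ≤′-refl; ≤′-step; z≤n; s≤s; _≡ᵇ_)
open import Data.Nat.Properties
open import Data.Bool using (true; false; if_then_else_)
open import Data.Product using (Σ; _×_; _,_; proj₁; proj₂; ∃; ∃₂)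
open import Data.Sum using (_⊎_; inj₁; inj₂)
import Data.Sum as Sum
open import Data.Unit using (⊤; tt)
open import Data.Empty using (⊥; ⊥-elim)
open import Data.Vec using (Vec; []; _∷_)
open import Data.Vec.Properties using (toList-map)
open import Data.List using ([]; _∷_; _++_)
open import Data.List.Relation.Unary.All using (All; []; _∷_)
import Data.List.Relation.Unary.All as All
import Data.List.Relation.Unary.All.Properties as All
open import Data.List.Relation.Binary.Subset.Propositional using (_⊆_)
open import Data.List.Relation.Binary.Subset.Propositional.Properties
  using (⊆-refl; ⊆-trans; ⊆-reflexive-↭; xs⊆x∷xs; xs⊆xs++ys; xs⊆ys++xs; ∷⁺ʳ; ∈-∷⁺ʳ)
open import Data.List.Relation.Unary.Any using (here; there)
open import Data.List.Relation.Binary.Permutation.Propositional using (↭-sym)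
open import Data.List.Relation.Binary.Permutation.Propositional.Properties using (shift)
open import Function.Definitions using (StrictlySurjective)
open import Relation.Binary using (Rel; Reflexive; Transitive; tri<; tri≈; tri>)
open import Relation.Binary.PropositionalEquality using (_≡_; refl; sym; trans; cong; cong₂; subst)
open import Relation.Nullary using (¬_; yes; no)
open import Relation.Unary using (_∪_; ｛_｝)

nextPair : ℕ × ℕ → ℕ × ℕ
nextPair (zero  , b) = suc b , zero
nextPair (suc a , b) = a , suc b

unpair : ℕ → ℕ × ℕ
unpair zero    = zero , zero
unpair (suc n) = nextPair (unpair n)

unpair-surjective : ∀ a b → ∃ λ n → unpair n ≡ (a , b)
unpair-surjective a b = reach (a + b) a b ≤-refl
  where
  reach : ∀ s a b → a + b ≤ s → ∃ λ n → unpair n ≡ (a , b)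
  reach s zero zero _ = zero , refl
  reach s a (suc b) a+b≤s =
    let n , eq = reach s (suc a) b (≤-trans (≤-reflexive (sym (+-suc a b))) a+b≤s)
    in suc n , cong nextPair eq
  reach (suc s) (suc a) zero a+b≤s =
    let n , eq = reach s zero a (≤-trans (≤-reflexive (sym (+-identityʳ a))) (≤-pred a+b≤s))
    in suc n , cong nextPair eq

unpair-+-≤ : ∀ n → proj₁ (unpair n) + proj₂ (unpair n) ≤ n
unpair-+-≤ zero    = z≤n
unpair-+-≤ (suc n) = ≤-trans (nextPair-+ (unpair n)) (s≤s (unpair-+-≤ n))
  where
  nextPair-+ : ∀ p → proj₁ (nextPair p) + proj₂ (nextPair p) ≤ suc (proj₁ p + proj₂ p)
  nextPair-+ (zero  , b) = ≤-reflexive (cong suc (+-identityʳ b))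
  nextPair-+ (suc a , b) = ≤-trans (≤-reflexive (+-suc a b)) (n≤1+n _)

pair : ℕ → ℕ → ℕ
pair a b = proj₁ (unpair-surjective a b)

unpair-pair : ∀ a b → unpair (pair a b) ≡ (a , b)
unpair-pair a b = proj₂ (unpair-surjective a b)

≤-pair : ∀ a b → b ≤ pair a b
≤-pair a b = subst (λ p → proj₂ p ≤ pair a b) (unpair-pair a b)
  (m+n≤o⇒n≤o (proj₁ (unpair (pair a b))) (unpair-+-≤ (pair a b)))

infinitely-often : ∀ {A : Set} {e : ℕ → A} → StrictlySurjective _≡_ e →
  ∀ a k → ∃ λ m → k ≤ m × e (proj₁ (unpair m)) ≡ a
infinitely-often {e = e} surj a k =
  let i , eᵢ = surj a
  in pair i k , ≤-pair i k , trans (cong (λ p → e (proj₁ p)) (unpair-pair i k)) eᵢ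

encodeVec : ∀ {n} → Vec Var n → ℕ
encodeVec []       = zero
encodeVec (v ∷ vs) = pair v (encodeVec vs)

decodeVec : (n : ℕ) → ℕ → Vec Var n
decodeVec zero    _ = []
decodeVec (suc n) c = let v , c′ = unpair c in v ∷ decodeVec n c′

decodeVec-encodeVec : ∀ {n} (vs : Vec Var n) → decodeVec n (encodeVec vs) ≡ vs
decodeVec-encodeVec []       = refl
decodeVec-encodeVec (v ∷ vs) rewrite unpair-pair v (encodeVec vs) =
  cong (v ∷_) (decodeVec-encodeVec vs)

encode : Formula → ℕ
encode (atom n P vs) = pair 0 (pair n (pair P (encodeVec vs)))
encode ⊤ᶠ            = pair 1 0
encode ⊥ᶠ            = pair 2 0
encode (φ ∧ᶠ ψ)      = pair 3 (pair (encode φ) (encode ψ))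
encode (¬ᶠ φ)        = pair 4 (encode φ)
encode (φ ⊃ ψ)       = pair 5 (pair (encode φ) (encode ψ))
encode (∀ᶠ x φ)      = pair 6 (pair x (encode φ))
encode (□ φ)         = pair 7 (encode φ)

depth : Formula → ℕ
depth (atom _ _ _) = 1
depth ⊤ᶠ           = 1
depth ⊥ᶠ           = 1
depth (φ ∧ᶠ ψ)     = suc (depth φ ⊔ depth ψ)
depth (¬ᶠ φ)       = suc (depth φ)
depth (φ ⊃ ψ)      = suc (depth φ ⊔ depth ψ)
depth (∀ᶠ _ φ)     = suc (depth φ)
depth (□ φ)        = suc (depth φ)

-- The first argument is fuel: a code decodes correctly once the fuel reaches the depth.
mutual
  decode : ℕ → ℕ → Formula
  decode zero    _ = ⊤ᶠ
  decode (suc f) c = decodeNode f (unpair c)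

  decodeNode : ℕ → ℕ × ℕ → Formula
  decodeNode f (0 , r) = let n , r′ = unpair r ; P , c = unpair r′ in atom n P (decodeVec n c)
  decodeNode f (1 , _) = ⊤ᶠ
  decodeNode f (2 , _) = ⊥ᶠ
  decodeNode f (3 , r) = let a , b = unpair r in decode f a ∧ᶠ decode f b
  decodeNode f (4 , r) = ¬ᶠ decode f r
  decodeNode f (5 , r) = let a , b = unpair r in decode f a ⊃ decode f b
  decodeNode f (6 , r) = let x , a = unpair r in ∀ᶠ x (decode f a)
  decodeNode f (_ , r) = □ (decode f r)

decode-encode : ∀ φ {f} → depth φ ≤ f → decode f (encode φ) ≡ φ
decode-encode (atom n P vs) {suc f} _
  rewrite unpair-pair 0 (pair n (pair P (encodeVec vs))) | unpair-pair n (pair P (encodeVec vs))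
        | unpair-pair P (encodeVec vs) = cong (atom n P) (decodeVec-encodeVec vs)
decode-encode ⊤ᶠ {suc f} _ rewrite unpair-pair 1 0 = refl
decode-encode ⊥ᶠ {suc f} _ rewrite unpair-pair 2 0 = refl
decode-encode (φ ∧ᶠ ψ) {suc f} (s≤s d)
  rewrite unpair-pair 3 (pair (encode φ) (encode ψ)) | unpair-pair (encode φ) (encode ψ) =
  cong₂ _∧ᶠ_ (decode-encode φ (m⊔n≤o⇒m≤o _ _ d)) (decode-encode ψ (m⊔n≤o⇒n≤o _ _ d))
decode-encode (¬ᶠ φ) {suc f} (s≤s d) rewrite unpair-pair 4 (encode φ) =
  cong ¬ᶠ_ (decode-encode φ d)
decode-encode (φ ⊃ ψ) {suc f} (s≤s d)
  rewrite unpair-pair 5 (pair (encode φ) (encode ψ)) | unpair-pair (encode φ) (encode ψ) =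
  cong₂ _⊃_ (decode-encode φ (m⊔n≤o⇒m≤o _ _ d)) (decode-encode ψ (m⊔n≤o⇒n≤o _ _ d))
decode-encode (∀ᶠ x φ) {suc f} (s≤s d)
  rewrite unpair-pair 6 (pair x (encode φ)) | unpair-pair x (encode φ) =
  cong (∀ᶠ x) (decode-encode φ d)
decode-encode (□ φ) {suc f} (s≤s d) rewrite unpair-pair 7 (encode φ) =
  cong □ (decode-encode φ d)

formulaAt : ℕ → Formula
formulaAt n = let f , c = unpair n in decode f c

formulaAt-surjective : StrictlySurjective _≡_ formulaAt
formulaAt-surjective φ = pair (depth φ) (encode φ) , goal
  where
  goal : formulaAt (pair (depth φ) (encode φ)) ≡ φ
  goal rewrite unpair-pair (depth φ) (encode φ) = decode-encode φ ≤-refl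

enum : ℕ → Formula
enum m = formulaAt (proj₁ (unpair m))

enum-often : ∀ φ k → ∃ λ m → k ≤ m × enum m ≡ φ
enum-often = infinitely-often formulaAt-surjective

chain-mono : ∀ {a ℓ} {A : Set a} (_≼_ : Rel A ℓ) → Reflexive _≼_ → Transitive _≼_ →
  {f : ℕ → A} → (∀ n → f n ≼ f (suc n)) → ∀ {m n} → m ≤ n → f m ≼ f n
chain-mono _≼_ refl′ trans′ {f} step m≤n = go (≤⇒≤′ m≤n)
  where
  go : ∀ {m n} → m ≤′ n → f m ≼ f n
  go ≤′-refl       = refl′
  go (≤′-step m≤n) = trans′ (go m≤n) (step _)

All-chain : ∀ {A : Set} {F : ℕ → A → Set} → (∀ {m n} → m ≤ n → ∀ x → F m x → F n x) →
  ∀ {xs} → All (λ x → ∃ λ n → F n x) xs → ∃ λ N → All (F N) xs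
All-chain mono []             = zero , []
All-chain mono ((n , p) ∷ ps) =
  let N , qs = All-chain mono ps
  in n ⊔ N , mono (m≤m⊔n n N) _ p ∷ All.map (λ {x} → mono (m≤n⊔m n N) x) qs

module Outside {U : VarSet} (cof : Coinfinite U) where

  outside : ℕ → Var
  outside zero    = proj₁ (cof zero)
  outside (suc k) = proj₁ (cof (suc (outside k)))

  outside-∉ : ∀ k → ¬ U (outside k)
  outside-∉ zero    = proj₂ (proj₂ (cof zero))
  outside-∉ (suc k) = proj₂ (proj₂ (cof (suc (outside k))))

  outside-step : ∀ k → outside k < outside (suc k)
  outside-step k = proj₁ (proj₂ (cof (suc (outside k))))

  outside-< : ∀ {k l} → k < l → outside k < outside l
  outside-< {k} k<l = <-≤-trans (outside-step k)
    (chain-mono _≤_ ≤-refl ≤-trans (λ n → <⇒≤ (outside-step n)) k<l)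

  outside-injective : ∀ {k l} → outside k ≡ outside l → k ≡ l
  outside-injective {k} {l} eq with <-cmp k l
  ... | tri< k<l _ _ = ⊥-elim (<-irrefl eq (outside-< k<l))
  ... | tri≈ _ k≡l _ = k≡l
  ... | tri> _ _ l<k = ⊥-elim (<-irrefl (sym eq) (outside-< l<k))

  outside-≥ : ∀ k → k ≤ outside k
  outside-≥ zero    = z≤n
  outside-≥ (suc k) = <-≤-trans (s≤s (outside-≥ k)) (outside-step k)

private variable
  V W : VarSet
  S T S′ : FSet
  φ ψ : Formula
  x y z : Var

All-InΦ : SubΦ V S → ∀ {Γ} → All S Γ → All (InΦ V) Γ
All-InΦ S⊆ = All.map (λ {φ} → S⊆ φ)

InΦ-mono : V ⊆ᵛ W → ∀ φ → InΦ V φ → InΦ W φ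
InΦ-mono V⊆W _ = All.map (λ {v} → V⊆W v)

InΦ-[/] : ∀ φ → InΦ V φ → V z → InΦ V (φ [ z / x ])
InΦ-[/] {V} {z} {x} (atom n P vs) i vz =
  subst (All V) (sym (toList-map _ vs)) (All.map⁺ (All.map (λ {v} → renamed v) i))
  where
  renamed : ∀ v → V v → V (if v ≡ᵇ x then z else v)
  renamed v vv with v ≡ᵇ x
  ... | true  = vz
  ... | false = vv
InΦ-[/] ⊤ᶠ       i vz = []
InΦ-[/] ⊥ᶠ       i vz = []
InΦ-[/] (φ ∧ᶠ ψ) i vz =
  let iφ , iψ = All.++⁻ (vars φ) i in All.++⁺ (InΦ-[/] φ iφ vz) (InΦ-[/] ψ iψ vz)
InΦ-[/] (¬ᶠ φ)   i vz = InΦ-[/] φ i vz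
InΦ-[/] (φ ⊃ ψ)  i vz =
  let iφ , iψ = All.++⁻ (vars φ) i in All.++⁺ (InΦ-[/] φ iφ vz) (InΦ-[/] ψ iψ vz)
InΦ-[/] {x = x} (∀ᶠ y φ) (vy ∷ i) vz with y ≡ᵇ x
... | true  = vy ∷ i
... | false = vy ∷ InΦ-[/] φ i vz
InΦ-[/] (□ φ)    i vz = InΦ-[/] φ i vz

¬OccursIn : ∀ {Γ} → All (InΦ V) Γ → ¬ V y → ¬ OccursIn y Γ
¬OccursIn i ¬vy y∈ = ¬vy (All.lookup (All.concat⁺ (All.map⁺ i)) y∈)

SubΦ-∪ : SubΦ V S → SubΦ V S′ → SubΦ V (S ∪ S′)
SubΦ-∪ S⊆ S′⊆ φ = Sum.[ S⊆ φ , S′⊆ φ ]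

SubΦ-｛｝ : InΦ V φ → SubΦ V ｛ φ ｝
SubΦ-｛｝ i _ refl = i

Entails Refutes : FSet → FSet → Formula → Set
Entails S T φ = ∃₂ λ Γ Δ → All S Γ × All T Δ × (Γ ⟶ φ ∷ Δ)
Refutes S T φ = ∃₂ λ Γ Δ → All S Γ × All T Δ × (φ ∷ Γ ⟶ Δ)

split : ∀ {A : Set} {P : A → Set} {a xs} → All (P ∪ ｛ a ｝) xs → ∃ λ ys → All P ys × xs ⊆ a ∷ ys
split []                = [] , [] , λ ()
split (inj₁ px  ∷ pxs) =
  let ys , pys , xs⊆ = split pxs
  in _ ∷ ys , px ∷ pys , ∈-∷⁺ʳ (there (here refl)) (⊆-trans xs⊆ (∷⁺ʳ _ (xs⊆x∷xs ys _)))
split (inj₂ refl ∷ pxs) =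
  let ys , pys , xs⊆ = split pxs
  in ys , pys , ∈-∷⁺ʳ (here refl) xs⊆

FC-∪ˡ : ¬ Refutes S T φ → FinitelyConsistent (S ∪ ｛ φ ｝) T
FC-∪ˡ ¬ref Γ Δ sΓ tΔ d = let Γ′ , sΓ′ , Γ⊆ = split sΓ in ¬ref (Γ′ , Δ , sΓ′ , tΔ , weak d Γ⊆ ⊆-refl)

FC-∪ʳ : ¬ Entails S T φ → FinitelyConsistent S (T ∪ ｛ φ ｝)
FC-∪ʳ ¬ent Γ Δ sΓ tΔ d = let Δ′ , tΔ′ , Δ⊆ = split tΔ in ¬ent (Γ , Δ′ , sΓ , tΔ′ , weak d ⊆-refl Δ⊆)

entails⊎FC-∪ʳ : ExcludedMiddle 0ℓ → ∀ S T φ → Entails S T φ ⊎ FinitelyConsistent S (T ∪ ｛ φ ｝)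
entails⊎FC-∪ʳ em S T φ with em {Entails S T φ}
... | yes ent = inj₁ ent
... | no ¬ent = inj₂ (FC-∪ʳ ¬ent)

Absorbed : FSet → Formula → Set
Absorbed S ψ = ∃ λ σ → S σ × (∀ {Γ Δ} → ψ ∷ Γ ⟶ Δ → σ ∷ Γ ⟶ Δ)

FC-absorb : FinitelyConsistent S T → (∀ {ψ} → S′ ψ → Absorbed S ψ) → FinitelyConsistent S′ T
FC-absorb {S} {T} {S′} fc absorb Γ Δ s′Γ tΔ d = go s′Γ [] (weak d (xs⊆xs++ys Γ []) ⊆-refl)
  where
  go : ∀ {Γ Γ₀} → All S′ Γ → All S Γ₀ → Γ ++ Γ₀ ⟶ Δ → ⊥
  go {Γ₀ = Γ₀} [] sΓ₀ d = fc Γ₀ Δ sΓ₀ tΔ d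
  go {ψ ∷ Γ} {Γ₀} (s′ψ ∷ s′Γ) sΓ₀ d =
    let σ , sσ , trade = absorb s′ψ
    in go s′Γ (sσ ∷ sΓ₀) (weak (trade d) (⊆-reflexive-↭ (↭-sym (shift σ Γ Γ₀))) ⊆-refl)

Instances : VarSet → Var → Formula → FSet
Instances V x φ ψ = ∃ λ z → V z × φ [ z / x ] ≡ ψ

FC-∧S : FinitelyConsistent S T → S (φ ∧ᶠ ψ) → FinitelyConsistent (S ∪ (｛ φ ｝ ∪ ｛ ψ ｝)) T
FC-∧S fc s = FC-absorb fc λ
  { (inj₁ s′)          → _ , s′ , λ d → d
  ; (inj₂ (inj₁ refl)) → _ , s , ∧L₁
  ; (inj₂ (inj₂ refl)) → _ , s , ∧L₂ }

FC-⊃S : FinitelyConsistent S T → S (φ ⊃ ψ) → Entails S T φ → FinitelyConsistent (S ∪ ｛ ψ ｝) T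
FC-⊃S fc s (Γ₁ , Δ₁ , sΓ₁ , tΔ₁ , d₁) = FC-∪ˡ λ (Γ , Δ , sΓ , tΔ , d) →
  fc _ _ (s ∷ All.++⁺ sΓ₁ sΓ) (All.++⁺ tΔ₁ tΔ) (⊃L d₁ d)

FC-¬S : FinitelyConsistent S T → S (¬ᶠ φ) → FinitelyConsistent S (T ∪ ｛ φ ｝)
FC-¬S fc s = FC-∪ʳ λ (Γ , Δ , sΓ , tΔ , d) → fc _ Δ (s ∷ sΓ) tΔ (¬L d)

FC-∀S : FinitelyConsistent S T → S (∀ᶠ x φ) → FinitelyConsistent (S ∪ Instances V x φ) T
FC-∀S fc s = FC-absorb fc λ
  { (inj₁ s′)            → _ , s′ , λ d → d
  ; (inj₂ (z , _ , refl)) → _ , s , ∀L z }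

FC-∧T : FinitelyConsistent S T → T (φ ∧ᶠ ψ) → Entails S T φ → FinitelyConsistent S (T ∪ ｛ ψ ｝)
FC-∧T fc t (Γ₁ , Δ₁ , sΓ₁ , tΔ₁ , d₁) = FC-∪ʳ λ (Γ , Δ , sΓ , tΔ , d) →
  fc (Γ₁ ++ Γ) (_ ∷ Δ₁ ++ Δ) (All.++⁺ sΓ₁ sΓ) (t ∷ All.++⁺ tΔ₁ tΔ)
    (∧R (weak d₁ (xs⊆xs++ys Γ₁ Γ) (∷⁺ʳ _ (xs⊆xs++ys Δ₁ Δ)))
        (weak d  (xs⊆ys++xs Γ Γ₁) (∷⁺ʳ _ (xs⊆ys++xs Δ Δ₁))))

FC-⊃T : FinitelyConsistent S T → T (φ ⊃ ψ) → FinitelyConsistent (S ∪ ｛ φ ｝) (T ∪ ｛ ψ ｝)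
FC-⊃T {S} {T} {φ} {ψ} fc t = FC-∪ʳ λ (Γ , Δ , sΓ , tΔ , d) →
  fcφ Γ _ sΓ (t ∷ tΔ) (⊃R (weak d (xs⊆x∷xs Γ φ) ⊆-refl))
  where
  fcφ : FinitelyConsistent (S ∪ ｛ φ ｝) T
  fcφ = FC-∪ˡ λ (Γ , Δ , sΓ , tΔ , d) → fc Γ _ sΓ (t ∷ tΔ) (⊃R (weak d ⊆-refl (xs⊆x∷xs Δ ψ)))

FC-¬T : FinitelyConsistent S T → T (¬ᶠ φ) → FinitelyConsistent (S ∪ ｛ φ ｝) T
FC-¬T fc t = FC-∪ˡ λ (Γ , Δ , sΓ , tΔ , d) → fc Γ _ sΓ (t ∷ tΔ) (¬R d)

FC-∀T : FinitelyConsistent S T → SubΦ V S → SubΦ V T → ¬ V y → T (∀ᶠ x φ) →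
  FinitelyConsistent S (T ∪ ｛ φ [ y / x ] ｝)
FC-∀T fc S⊆ T⊆ ¬vy t = FC-∪ʳ λ (Γ , Δ , sΓ , tΔ , d) →
  fc Γ _ sΓ (t ∷ tΔ) (∀R d (¬OccursIn (All.++⁺ (All-InΦ S⊆ sΓ) (All-InΦ T⊆ (t ∷ tΔ))) ¬vy))

Pair : Set₁
Pair = FSet × FSet

_⊑_ : Pair → Pair → Set
(S , T) ⊑ (S′ , T′) = S ⊆ᶠ S′ × T ⊆ᶠ T′

⊑-refl : Reflexive _⊑_
⊑-refl = (λ _ s → s) , (λ _ t → t)

⊑-trans : Transitive _⊑_
⊑-trans (S⊆ , T⊆) (S⊆′ , T⊆′) = (λ φ s → S⊆′ φ (S⊆ φ s)) , (λ φ t → T⊆′ φ (T⊆ φ t))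

record ConsistentIn (V : VarSet) (p : Pair) : Set where
  field
    subS    : SubΦ V (proj₁ p)
    subT    : SubΦ V (proj₂ p)
    fincons : FinitelyConsistent (proj₁ p) (proj₂ p)

open ConsistentIn

ConsistentIn-mono : V ⊆ᵛ W → ∀ {p} → ConsistentIn V p → ConsistentIn W p
ConsistentIn-mono V⊆W c = record
  { subS = λ φ s → InΦ-mono V⊆W φ (subS c φ s)
  ; subT = λ φ t → InΦ-mono V⊆W φ (subT c φ t)
  ; fincons = fincons c }

SClause TClause : VarSet → Formula → Pair → Set
SClause V (φ ∧ᶠ ψ)     (S , T) = S φ × S ψ
SClause V (φ ⊃ ψ)      (S , T) = T φ ⊎ S ψ
SClause V (¬ᶠ φ)       (S , T) = T φ
SClause V (∀ᶠ x φ)     (S , T) = ∀ z → V z → S (φ [ z / x ])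
SClause V (atom _ _ _) _       = ⊤
SClause V ⊤ᶠ           _       = ⊤
SClause V ⊥ᶠ           _       = ⊤
SClause V (□ _)        _       = ⊤
TClause V (φ ∧ᶠ ψ)     (S , T) = T φ ⊎ T ψ
TClause V (φ ⊃ ψ)      (S , T) = S φ × T ψ
TClause V (¬ᶠ φ)       (S , T) = S φ
TClause V (∀ᶠ x φ)     (S , T) = ∃ λ z → V z × T (φ [ z / x ])
TClause V (atom _ _ _) _       = ⊤
TClause V ⊤ᶠ           _       = ⊤
TClause V ⊥ᶠ           _       = ⊤
TClause V (□ _)        _       = ⊤

SClause-mono : ∀ χ {p q} → W ⊆ᵛ V → p ⊑ q → SClause V χ p → SClause W χ q
SClause-mono (φ ∧ᶠ ψ)     _   (S⊆ , _)  (sφ , sψ) = S⊆ φ sφ , S⊆ ψ sψ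
SClause-mono (φ ⊃ ψ)      _   (S⊆ , T⊆) c         = Sum.map (T⊆ φ) (S⊆ ψ) c
SClause-mono (¬ᶠ φ)       _   (_ , T⊆)  c         = T⊆ φ c
SClause-mono (∀ᶠ x φ)     W⊆V (S⊆ , _)  c z wz    = S⊆ _ (c z (W⊆V z wz))
SClause-mono (atom _ _ _) _   _         _         = tt
SClause-mono ⊤ᶠ           _   _         _         = tt
SClause-mono ⊥ᶠ           _   _         _         = tt
SClause-mono (□ _)        _   _         _         = tt

TClause-mono : ∀ χ {p q} → V ⊆ᵛ W → p ⊑ q → TClause V χ p → TClause W χ q
TClause-mono (φ ∧ᶠ ψ)     _   (_ , T⊆)  c               = Sum.map (T⊆ φ) (T⊆ ψ) c
TClause-mono (φ ⊃ ψ)      _   (S⊆ , T⊆) (sφ , tψ)       = S⊆ φ sφ , T⊆ ψ tψ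
TClause-mono (¬ᶠ φ)       _   (S⊆ , _)  c               = S⊆ φ c
TClause-mono (∀ᶠ x φ)     V⊆W (_ , T⊆)  (z , vz , t)    = z , V⊆W z vz , T⊆ _ t
TClause-mono (atom _ _ _) _   _         _               = tt
TClause-mono ⊤ᶠ           _   _         _               = tt
TClause-mono ⊥ᶠ           _   _         _               = tt
TClause-mono (□ _)        _   _         _               = tt

record Extension (V : VarSet) (p : Pair) (P : Pair → Set) : Set₁ where
  constructor extension
  field
    next       : Pair
    grows      : p ⊑ next
    consistent : ConsistentIn V next
    property   : P next

open Extension

Extension-map : ∀ {p} {P Q : Pair → Set} → (∀ {q} → P q → Q q) → Extension V p P → Extension V p Q
Extension-map f (extension q grows c prop) = extension q grows c (f prop)

stay : ∀ {p} {P : Pair → Set} → ConsistentIn V p → P p → Extension V p P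
stay c = extension _ ⊑-refl c

extendˡ : ∀ {A} {P : Pair → Set} → ConsistentIn V (S , T) → SubΦ V A →
  FinitelyConsistent (S ∪ A) T → P (S ∪ A , T) → Extension V (S , T) P
extendˡ c A⊆ fc = extension _ ((λ _ → inj₁) , (λ _ t → t))
  (record { subS = SubΦ-∪ (subS c) A⊆ ; subT = subT c ; fincons = fc })

extendʳ : ∀ {B} {P : Pair → Set} → ConsistentIn V (S , T) → SubΦ V B →
  FinitelyConsistent S (T ∪ B) → P (S , T ∪ B) → Extension V (S , T) P
extendʳ c B⊆ fc = extension _ ((λ _ s → s) , (λ _ → inj₁))
  (record { subS = subS c ; subT = SubΦ-∪ (subT c) B⊆ ; fincons = fc })

extendˡʳ : ∀ {A B} {P : Pair → Set} → ConsistentIn V (S , T) → SubΦ V A → SubΦ V B →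
  FinitelyConsistent (S ∪ A) (T ∪ B) → P (S ∪ A , T ∪ B) → Extension V (S , T) P
extendˡʳ c A⊆ B⊆ fc = extension _ ((λ _ → inj₁) , (λ _ → inj₁))
  (record { subS = SubΦ-∪ (subS c) A⊆ ; subT = SubΦ-∪ (subT c) B⊆ ; fincons = fc })

module _ (em : ExcludedMiddle 0ℓ) where

  extendS : ∀ χ → ConsistentIn V (S , T) → S χ → Extension V (S , T) (SClause V χ)
  extendS (φ ∧ᶠ ψ) c s =
    let iφ , iψ = All.++⁻ (vars φ) (subS c _ s)
    in extendˡ c (SubΦ-∪ (SubΦ-｛｝ iφ) (SubΦ-｛｝ iψ)) (FC-∧S (fincons c) s)
         (inj₂ (inj₁ refl) , inj₂ (inj₂ refl))
  extendS {S = S} {T} (φ ⊃ ψ) c s with entails⊎FC-∪ʳ em S T φ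
  ... | inj₁ ent = extendˡ c (SubΦ-｛｝ (proj₂ (All.++⁻ (vars φ) (subS c _ s))))
                     (FC-⊃S (fincons c) s ent) (inj₂ (inj₂ refl))
  ... | inj₂ fc  = extendʳ c (SubΦ-｛｝ (proj₁ (All.++⁻ (vars φ) (subS c _ s)))) fc (inj₁ (inj₂ refl))
  extendS (¬ᶠ φ) c s = extendʳ c (SubΦ-｛｝ (subS c _ s)) (FC-¬S (fincons c) s) (inj₂ refl)
  extendS {V} (∀ᶠ x φ) c s = extendˡ c instances⊆ (FC-∀S (fincons c) s) (λ z vz → inj₂ (z , vz , refl))
    where
    instances⊆ : SubΦ V (Instances V x φ)
    instances⊆ _ (z , vz , refl) = InΦ-[/] φ (All.tail (subS c _ s)) vz
  extendS (atom _ _ _) c _ = stay c tt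
  extendS ⊤ᶠ           c _ = stay c tt
  extendS ⊥ᶠ           c _ = stay c tt
  extendS (□ _)        c _ = stay c tt

  extendT : ∀ χ → ConsistentIn V (S , T) → ¬ V y → T χ →
    Extension (V ∪ ｛ y ｝) (S , T) (TClause (V ∪ ｛ y ｝) χ)
  extendT {V} {S} {T} {y} χ c ¬vy = go χ
    where
    c⁺ : ConsistentIn (V ∪ ｛ y ｝) (S , T)
    c⁺ = ConsistentIn-mono (λ _ → inj₁) c

    go : ∀ χ → T χ → Extension (V ∪ ｛ y ｝) (S , T) (TClause (V ∪ ｛ y ｝) χ)
    go (φ ∧ᶠ ψ) t with entails⊎FC-∪ʳ em S T φ
    ... | inj₁ ent = extendʳ c⁺ (SubΦ-｛｝ (proj₂ (All.++⁻ (vars φ) (subT c⁺ _ t))))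
                       (FC-∧T (fincons c) t ent) (inj₂ (inj₂ refl))
    ... | inj₂ fc  = extendʳ c⁺ (SubΦ-｛｝ (proj₁ (All.++⁻ (vars φ) (subT c⁺ _ t))))
                       fc (inj₁ (inj₂ refl))
    go (φ ⊃ ψ) t =
      let iφ , iψ = All.++⁻ (vars φ) (subT c⁺ _ t)
      in extendˡʳ c⁺ (SubΦ-｛｝ iφ) (SubΦ-｛｝ iψ) (FC-⊃T (fincons c) t) (inj₂ refl , inj₂ refl)
    go (¬ᶠ φ) t = extendˡ c⁺ (SubΦ-｛｝ (subT c⁺ _ t)) (FC-¬T (fincons c) t) (inj₂ refl)
    go (∀ᶠ x φ) t =
      extendʳ c⁺ (SubΦ-｛｝ (InΦ-[/] φ (All.tail (subT c⁺ _ t)) (inj₂ refl)))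
        (FC-∀T (fincons c) (subS c) (subT c) ¬vy t) (y , inj₂ refl , inj₂ refl)
    go (atom _ _ _) _ = stay c⁺ tt
    go ⊤ᶠ           _ = stay c⁺ tt
    go ⊥ᶠ           _ = stay c⁺ tt
    go (□ _)        _ = stay c⁺ tt

  extendIfS : ∀ χ p → ConsistentIn V p → Extension V p (λ q → proj₁ p χ → SClause V χ q)
  extendIfS χ p c with em {proj₁ p χ}
  ... | yes s = Extension-map (λ sat _ → sat) (extendS χ c s)
  ... | no ¬s = stay c (λ s → ⊥-elim (¬s s))

  extendIfT : ∀ χ p → ConsistentIn V p → ¬ V y →
    Extension (V ∪ ｛ y ｝) p (λ q → proj₂ p χ → TClause (V ∪ ｛ y ｝) χ q)
  extendIfT χ p c ¬vy with em {proj₂ p χ}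
  ... | yes t = Extension-map (λ sat _ → sat) (extendT χ c ¬vy t)
  ... | no ¬t = stay (ConsistentIn-mono (λ _ → inj₁) c) (λ t → ⊥-elim (¬t t))

  step : ∀ χ p → ConsistentIn V p → ¬ V y →
    Extension (V ∪ ｛ y ｝) p
      (λ q → (proj₁ p χ → SClause V χ q) × (proj₂ p χ → TClause (V ∪ ｛ y ｝) χ q))
  step χ p c ¬vy =
    let e₁ = extendIfS χ p c
        e₂ = extendIfT χ (next e₁) (consistent e₁) ¬vy
    in extension (next e₂) (⊑-trans (grows e₁) (grows e₂)) (consistent e₂)
         ( (λ s → SClause-mono χ (λ _ v → v) (grows e₂) (property e₁ s))
         , (λ t → property e₂ (proj₂ (grows e₁) χ t)) )

module Construction (em : ExcludedMiddle 0ℓ) {U : VarSet} (cof : Coinfinite U)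
                    {S₀ T₀ : FSet} (c₀ : ConsistentIn U (S₀ , T₀)) where

  open Outside cof

  fresh : ℕ → Var
  fresh i = outside (2 * i)

  varsAt : ℕ → VarSet
  varsAt zero    = U
  varsAt (suc n) = varsAt n ∪ ｛ fresh n ｝

  varsAt-origin : ∀ n {v} → varsAt n v → U v ⊎ ∃ λ i → i < n × fresh i ≡ v
  varsAt-origin zero    u           = inj₁ u
  varsAt-origin (suc n) (inj₂ refl) = inj₂ (n , n<1+n n , refl)
  varsAt-origin (suc n) (inj₁ v) with varsAt-origin n v
  ... | inj₁ u              = inj₁ u
  ... | inj₂ (i , i<n , eq) = inj₂ (i , m<n⇒m<1+n i<n , eq)

  fresh-∉ : ∀ n → ¬ varsAt n (fresh n)
  fresh-∉ n v with varsAt-origin n v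
  ... | inj₁ u              = outside-∉ (2 * n) u
  ... | inj₂ (i , i<n , eq) = <-irrefl (*-cancelˡ-≡ i n 2 (outside-injective eq)) i<n

  varsAt-mono : ∀ {m n} → m ≤ n → varsAt m ⊆ᵛ varsAt n
  varsAt-mono = chain-mono _⊆ᵛ_ (λ _ v → v) (λ V⊆W W⊆X x v → W⊆X x (V⊆W x v)) (λ _ _ → inj₁)

  Stage : ℕ → Set₁
  Stage n = Σ Pair (ConsistentIn (varsAt n))

  advance : ∀ n (s : Stage n) → Extension (varsAt (suc n)) (proj₁ s)
    (λ q → (proj₁ (proj₁ s) (enum n) → SClause (varsAt n) (enum n) q)
         × (proj₂ (proj₁ s) (enum n) → TClause (varsAt (suc n)) (enum n) q))
  advance n (p , c) = step em (enum n) p c (fresh-∉ n)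

  stage : (n : ℕ) → Stage n
  stage zero    = (S₀ , T₀) , c₀
  stage (suc n) = let e = advance n (stage n) in next e , consistent e

  pairAt : ℕ → Pair
  pairAt n = proj₁ (stage n)

  pairAt-mono : ∀ {m n} → m ≤ n → pairAt m ⊑ pairAt n
  pairAt-mono = chain-mono _⊑_ ⊑-refl ⊑-trans (λ n → grows (advance n (stage n)))

  Uω : VarSet
  Uω v = ∃ λ n → varsAt n v

  Sω Tω : FSet
  Sω φ = ∃ λ n → proj₁ (pairAt n) φ
  Tω φ = ∃ λ n → proj₂ (pairAt n) φ

  pairAt⊑limit : ∀ n → pairAt n ⊑ (Sω , Tω)
  pairAt⊑limit n = (λ _ s → n , s) , (λ _ t → n , t)

  SClause-eventually : ∀ χ → Sω χ → ∀ j → ∃ λ m → SClause (varsAt j) χ (pairAt m)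
  SClause-eventually χ (k , s) j with enum-often χ (k ⊔ j)
  ... | m , k⊔j≤m , refl =
    suc m , SClause-mono (enum m) (varsAt-mono (m⊔n≤o⇒n≤o k j k⊔j≤m)) ⊑-refl
              (proj₁ (property (advance m (stage m))) (proj₁ (pairAt-mono (m⊔n≤o⇒m≤o k j k⊔j≤m)) _ s))

  limit-SClause : ∀ χ → Sω χ → SClause Uω χ (Sω , Tω)
  limit-SClause (φ ∧ᶠ ψ) s = let m , sφ , sψ = SClause-eventually _ s 0 in (m , sφ) , (m , sψ)
  limit-SClause (φ ⊃ ψ)  s = let m , c = SClause-eventually _ s 0 in Sum.map (m ,_) (m ,_) c
  limit-SClause (¬ᶠ φ)   s = let m , t = SClause-eventually _ s 0 in m , t
  limit-SClause (∀ᶠ x φ) s z (j , vz) = let m , c = SClause-eventually _ s j in m , c z vz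
  limit-SClause (atom _ _ _) _ = tt
  limit-SClause ⊤ᶠ           _ = tt
  limit-SClause ⊥ᶠ           _ = tt
  limit-SClause (□ _)        _ = tt

  limit-TClause : ∀ χ → Tω χ → TClause Uω χ (Sω , Tω)
  limit-TClause χ (k , t) with enum-often χ k
  ... | m , k≤m , refl =
    TClause-mono (enum m) (λ _ v → suc m , v) (pairAt⊑limit (suc m))
      (proj₂ (property (advance m (stage m))) (proj₂ (pairAt-mono k≤m) _ t))

  limit-consistent : FinitelyConsistent Sω Tω
  limit-consistent Γ Δ sΓ tΔ d =
    let m , sΓ′ = All-chain (λ m≤n → proj₁ (pairAt-mono m≤n)) sΓ
        n , tΔ′ = All-chain (λ m≤n → proj₂ (pairAt-mono m≤n)) tΔ
    in fincons (proj₂ (stage (m ⊔ n))) Γ Δ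
         (All.map (λ {φ} → proj₁ (pairAt-mono (m≤m⊔n m n)) φ) sΓ′)
         (All.map (λ {φ} → proj₂ (pairAt-mono (m≤n⊔m m n)) φ) tΔ′) d

  saturated : Saturated Uω Sω Tω
  saturated = record
    { subS    = λ { φ (n , s) → InΦ-mono (λ _ v → n , v) φ (subS (proj₂ (stage n)) φ s) }
    ; subT    = λ { φ (n , t) → InΦ-mono (λ _ v → n , v) φ (subT (proj₂ (stage n)) φ t) }
    ; fincons = limit-consistent
    ; ∧S = λ φ ψ → limit-SClause (φ ∧ᶠ ψ)
    ; ∧T = λ φ ψ → limit-TClause (φ ∧ᶠ ψ)
    ; ⊃S = λ φ ψ → limit-SClause (φ ⊃ ψ)
    ; ⊃T = λ φ ψ → limit-TClause (φ ⊃ ψ)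
    ; ¬S = λ φ → limit-SClause (¬ᶠ φ)
    ; ¬T = λ φ → limit-TClause (¬ᶠ φ)
    ; ∀S = λ x φ → limit-SClause (∀ᶠ x φ)
    ; ∀T = λ x φ → limit-TClause (∀ᶠ x φ) }

  coinfinite : Coinfinite Uω
  coinfinite n = outside (suc (2 * n)) , ≤-trans (m≤n*m n 2) (≤-trans (n≤1+n _) (outside-≥ _)) , ∉Uω
    where
    ∉Uω : ¬ Uω (outside (suc (2 * n)))
    ∉Uω (j , v) with varsAt-origin j v
    ... | inj₁ u           = outside-∉ (suc (2 * n)) u
    ... | inj₂ (i , _ , eq) = even≢odd i n (outside-injective eq)

theorem6 : ExcludedMiddle 0ℓ →
    (U : VarSet) (S T : FSet) →
    Coinfinite U → SubΦ U S → SubΦ U T → FinitelyConsistent S T →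
    Σ VarSet λ U' → Σ FSet λ S' → Σ FSet λ T' →
      Coinfinite U' × Saturated U' S' T' ×
      U ⊆ᵛ U' × S ⊆ᶠ S' × T ⊆ᶠ T'
theorem6 em U S T cof S⊆Φ T⊆Φ fc =
  Uω , Sω , Tω , coinfinite , saturated , (λ _ u → 0 , u) , (λ _ s → 0 , s) , (λ _ t → 0 , t)
  where
  consistent₀ : ConsistentIn U (S , T)
  consistent₀ = record { subS = S⊆Φ ; subT = T⊆Φ ; fincons = fc }

  open Construction em cof consistent₀
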